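{- Let $k\ge0$. Let $f_k(x)=\sum_{n\ge0}\alpha_{n,k}x^n$, where $\alpha_{n,k}$ is the number of words of length $n$ on $\{1,\dots,k\}$ in which every letter of $\{1,\dots,k\}$ occurs and which avoid both generalized patterns $1-11$ and $1-12$. Let $C_k(x)=\sum_{n\ge0}c_{n,k}x^n$, where $c_{n,k}$ is the number of such words (length $n$, all letters of $\{1,\dots,k\}$ occurring, avoiding $1-11$ and $1-12$) whose last letter occurs nowhere else in the word, with $C_0(x)=1$. Then \[ f_k(x)=(1+x)^k\,C_k(x). \]
   Context: Words are finite sequences $w_1\cdots w_n$ over a totally ordered alphabet $\{1,\dots,k\}$. A word $w$ contains the generalized pattern $1-11$ iff there exist indices $1\le i<j<n$ with $w_i=w_j=w_{j+1}$, and contains $1-12$ iff there exist $i<j<n$ with $w_i=w_j<w_{j+1}$; it avoids a pattern if it does not contain it. -}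

module Defs where

open import Data.Nat using (ℕ; zero; suc; _<_; _<?_; _∸_; _*_) renaming (_≟_ to _≟ℕ_)
open import Data.Nat.Combinatorics using (_C_)
open import Data.Fin using (Fin; toℕ; fromℕ) renaming (_≟_ to _≟ᶠ_; _<_ to _<ᶠ_; _<?_ to _<ᶠ?_)
open import Data.Fin.Properties using (any?; all?)
open import Data.Vec using (Vec; []; _∷_; lookup)
open import Data.List using (List; [_]; concatMap; map; filter; length; upTo; allFin)
open import Data.Nat.ListAction using (sum)
open import Data.Product using (Σ; ∃; _×_; _,_)
open import Data.Unit using (⊤; tt)
open import Relation.Binary.PropositionalEquality using (_≡_; _≢_)
open import Relation.Nullary using (Dec; yes; ¬_; ¬?)
open import Relation.Nullary.Decidable using (_×-dec_; _→-dec_)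

-- A word w₁⋯wₙ over the totally ordered alphabet {1,…,k}; letters are Fin k
-- (letter a stands for toℕ a + 1, order = order of Fin k).  Positions are
-- 0-based: position p : Fin n is the (toℕ p + 1)-th letter.
Word : ℕ → ℕ → Set
Word k n = Vec (Fin k) n

allWords : (k n : ℕ) → List (Word k n)
allWords k zero    = [ [] ]
allWords k (suc n) = concatMap (λ a → map (a ∷_) (allWords k n)) (allFin k)

Contains1-11 : ∀ {k n} → Word k n → Set
Contains1-11 {k} {n} w =
  ∃ λ (i : Fin n) → ∃ λ (j : Fin n) → ∃ λ (j' : Fin n) →
    (toℕ i < toℕ j) × (toℕ j' ≡ suc (toℕ j)) ×
    (lookup w i ≡ lookup w j) × (lookup w j ≡ lookup w j')

Contains1-12 : ∀ {k n} → Word k n → Set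
Contains1-12 {k} {n} w =
  ∃ λ (i : Fin n) → ∃ λ (j : Fin n) → ∃ λ (j' : Fin n) →
    (toℕ i < toℕ j) × (toℕ j' ≡ suc (toℕ j)) ×
    (lookup w i ≡ lookup w j) × (lookup w j <ᶠ lookup w j')

AllLettersOccur : ∀ {k n} → Word k n → Set
AllLettersOccur {k} {n} w = ∀ (a : Fin k) → ∃ λ (p : Fin n) → lookup w p ≡ a

-- Convention: the empty word satisfies it (this encodes C₀(x) = 1; for k ≥ 1
-- the empty word never has all letters occurring, so it is irrelevant there).
LastLetterUnique : ∀ {k n} → Word k n → Set
LastLetterUnique {k} {zero}  w = ⊤
LastLetterUnique {k} {suc m} w =
  ∀ (p : Fin (suc m)) → p ≢ fromℕ m → lookup w p ≢ lookup w (fromℕ m)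

Counted : ∀ {k n} → Word k n → Set
Counted w = AllLettersOccur w × ¬ Contains1-11 w × ¬ Contains1-12 w

contains1-11? : ∀ {k n} (w : Word k n) → Dec (Contains1-11 w)
contains1-11? w = any? λ i → any? λ j → any? λ j' →
  (toℕ i <? toℕ j) ×-dec (toℕ j' ≟ℕ suc (toℕ j)) ×-dec
  (lookup w i ≟ᶠ lookup w j) ×-dec (lookup w j ≟ᶠ lookup w j')

contains1-12? : ∀ {k n} (w : Word k n) → Dec (Contains1-12 w)
contains1-12? w = any? λ i → any? λ j → any? λ j' →
  (toℕ i <? toℕ j) ×-dec (toℕ j' ≟ℕ suc (toℕ j)) ×-dec
  (lookup w i ≟ᶠ lookup w j) ×-dec (lookup w j <ᶠ? lookup w j')

allLettersOccur? : ∀ {k n} (w : Word k n) → Dec (AllLettersOccur w)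
allLettersOccur? w = all? λ a → any? λ p → lookup w p ≟ᶠ a

lastLetterUnique? : ∀ {k n} (w : Word k n) → Dec (LastLetterUnique w)
lastLetterUnique? {k} {zero}  w = yes tt
lastLetterUnique? {k} {suc m} w = all? λ p →
  ¬? (p ≟ᶠ fromℕ m) →-dec ¬? (lookup w p ≟ᶠ lookup w (fromℕ m))

counted? : ∀ {k n} (w : Word k n) → Dec (Counted w)
counted? w = allLettersOccur? w ×-dec ¬? (contains1-11? w) ×-dec ¬? (contains1-12? w)

countedLast? : ∀ {k n} (w : Word k n) → Dec (Counted w × LastLetterUnique w)
countedLast? w = counted? w ×-dec lastLetterUnique? w

α : ℕ → ℕ → ℕ
α n k = length (filter counted? (allWords k n))

c : ℕ → ℕ → ℕ
c n k = length (filter countedLast? (allWords k n))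

-- n-th coefficient of (1+x)^k · C_k(x) = Σ_{j=0}^{n} binom(k,j) c_{n-j,k}
coeffProduct : ℕ → ℕ → ℕ
coeffProduct n k = sum (map (λ j → (k C j) * c (n ∸ j) k) (upTo (suc n)))

-- 1. A word avoids 1-11 and 1-12 iff it is *descending*: whenever the letter
--    at position p already occurred earlier, the letter at p+1 is smaller.
-- 2. Every word w splits uniquely as w = u ++ v where v is the longest suffix
--    all of whose positions are repeats (their letter occurred earlier in w);
--    the length j of this repeated tail is determined by w.
-- 3. For such a split, w is counted by α iff u is counted by c and v is
--    strictly decreasing: the letters of v all occur in u, the last letter
--    of u is new, and on the repeated tail descent is just strict decrease.
-- 4. There are C(k,j) strictly decreasing words of length j over k letters
--    (hockey-stick recursion on the first letter).
-- Step 2 turns α_{n,k} into a sum over j of the number of counted words with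
-- repeated tail of length j; steps 3 and 4 evaluate that number as
-- C(k,j) · c_{n-j,k}.
module Submission where

open import Defs
open import Data.Nat
open import Data.Nat.Properties
open import Data.Nat.Combinatorics using (_C_; nCk+nC[k+1]≡[n+1]C[k+1])
open import Data.Nat.ListAction using (sum)
open import Data.Nat.ListAction.Properties using (sum-++)
open import Data.List using (List; []; _∷_; _++_; map; concatMap; filter; length; upTo; applyUpTo; tabulate; allFin)
open import Data.List.Properties using (map-++; map-∘; map-cong)
open import Data.Fin using (Fin; toℕ; fromℕ; fromℕ<; _↑ˡ_; _↑ʳ_; splitAt) renaming (zero to fz; suc to fs; _≟_ to _≟ᶠ_)
open import Data.Fin.Properties using (toℕ<n; toℕ-injective; toℕ-fromℕ; toℕ-fromℕ<; toℕ-↑ˡ; toℕ-↑ʳ; splitAt⁻¹-↑ˡ; splitAt⁻¹-↑ʳ; toℕ≤pred[n]; any?; all?)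
open import Data.Vec using ([]; _∷_; lookup) renaming (_++_ to _++ᵥ_)
open import Data.Vec.Properties using (lookup-++ˡ; lookup-++ʳ)
open import Data.Product using (_×_; _,_; proj₁; proj₂; ∃)
open import Data.Sum using (_⊎_; inj₁; inj₂)
open import Data.Unit using (⊤; tt)
open import Data.Empty using (⊥; ⊥-elim)
open import Function using (_∘_)
open import Relation.Binary using (tri<; tri≈; tri>)
open import Relation.Binary.PropositionalEquality
open import Relation.Nullary using (Dec; yes; no; ¬_; ¬?)
open import Relation.Nullary.Decidable using (_×-dec_; _→-dec_)
open import Algebra.Properties.CommutativeSemigroup +-commutativeSemigroup using (interchange)

∑ : ∀ {a} {A : Set a} → List A → (A → ℕ) → ℕ
∑ xs f = sum (map f xs)

∑-++ : ∀ {a} {A : Set a} (xs ys : List A) f → ∑ (xs ++ ys) f ≡ ∑ xs f + ∑ ys f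
∑-++ xs ys f = trans (cong sum (map-++ f xs ys)) (sum-++ (map f xs) (map f ys))

∑-concatMap : ∀ {a b} {A : Set a} {B : Set b} (g : A → List B) xs f →
  ∑ (concatMap g xs) f ≡ ∑ xs (λ x → ∑ (g x) f)
∑-concatMap g []       f = refl
∑-concatMap g (x ∷ xs) f
  rewrite ∑-++ (g x) (concatMap g xs) f | ∑-concatMap g xs f = refl

∑-map : ∀ {a b} {A : Set a} {B : Set b} (h : A → B) xs f → ∑ (map h xs) f ≡ ∑ xs (f ∘ h)
∑-map h xs f = cong sum (sym (map-∘ xs))

∑-cong : ∀ {a} {A : Set a} (xs : List A) {f g} → (∀ x → f x ≡ g x) → ∑ xs f ≡ ∑ xs g
∑-cong xs e = cong sum (map-cong e xs)

∑-*ˡ : ∀ {a} {A : Set a} (xs : List A) c f → ∑ xs (λ x → c * f x) ≡ c * ∑ xs f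
∑-*ˡ []       c f = sym (*-zeroʳ c)
∑-*ˡ (x ∷ xs) c f rewrite ∑-*ˡ xs c f = sym (*-distribˡ-+ c (f x) _)

∑-*ʳ : ∀ {a} {A : Set a} (xs : List A) c f → ∑ xs (λ x → f x * c) ≡ ∑ xs f * c
∑-*ʳ xs c f = trans (∑-cong xs (λ x → *-comm (f x) c)) (trans (∑-*ˡ xs c f) (*-comm c _))

∑< : ℕ → (ℕ → ℕ) → ℕ
∑< zero    g = 0
∑< (suc n) g = ∑< n g + g n

∑<-cons : ∀ n g → ∑< (suc n) g ≡ g 0 + ∑< n (g ∘ suc)
∑<-cons zero    g = +-comm 0 (g 0)
∑<-cons (suc n) g rewrite ∑<-cons n g = +-assoc (g 0) _ _

∑<-cong : ∀ n {f g} → (∀ i → i < n → f i ≡ g i) → ∑< n f ≡ ∑< n g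
∑<-cong zero    e = refl
∑<-cong (suc n) e rewrite ∑<-cong n (λ i i<n → e i (m<n⇒m<1+n i<n)) | e n ≤-refl = refl

∑<-zero : ∀ n g → (∀ i → i < n → g i ≡ 0) → ∑< n g ≡ 0
∑<-zero zero    g e = refl
∑<-zero (suc n) g e rewrite ∑<-zero n g (λ i i<n → e i (m<n⇒m<1+n i<n)) | e n ≤-refl = refl

∑<-+ : ∀ n f g → ∑< n (λ i → f i + g i) ≡ ∑< n f + ∑< n g
∑<-+ zero    f g = refl
∑<-+ (suc n) f g rewrite ∑<-+ n f g = interchange (∑< n f) (∑< n g) (f n) (g n)

∑<-*ˡ : ∀ n c f → ∑< n (λ i → c * f i) ≡ c * ∑< n f
∑<-*ˡ zero    c f = sym (*-zeroʳ c)
∑<-*ˡ (suc n) c f rewrite ∑<-*ˡ n c f = sym (*-distribˡ-+ c _ (f n))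

∑-∑< : ∀ {a} {A : Set a} (xs : List A) n (f : A → ℕ → ℕ) →
  ∑ xs (λ x → ∑< n (f x)) ≡ ∑< n (λ i → ∑ xs (λ x → f x i))
∑-∑< []       n f = sym (∑<-zero n (λ _ → 0) (λ _ _ → refl))
∑-∑< (x ∷ xs) n f rewrite ∑-∑< xs n f = sym (∑<-+ n (f x) _)

∑-upTo : ∀ n g → ∑ (upTo n) g ≡ ∑< n g
∑-upTo n g = go n (λ i → i)
  where
  go : ∀ n (f : ℕ → ℕ) → ∑ (applyUpTo f n) g ≡ ∑< n (g ∘ f)
  go zero    f = refl
  go (suc n) f rewrite go n (f ∘ suc) = sym (∑<-cons n (g ∘ f))

∑-tabulate : ∀ n {B : Set} (f : Fin n → B) h g → (∀ a → h (f a) ≡ g (toℕ a)) →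
  ∑ (tabulate f) h ≡ ∑< n g
∑-tabulate zero    f h g e = refl
∑-tabulate (suc n) f h g e
  rewrite e fz | ∑-tabulate n (f ∘ fs) h (g ∘ suc) (λ a → e (fs a)) = sym (∑<-cons n g)

hockey-stick : ∀ b j → ∑< b (λ i → i C j) ≡ b C suc j
hockey-stick zero    j = refl
hockey-stick (suc b) j rewrite hockey-stick b j =
  trans (+-comm (b C suc j) (b C j)) (nCk+nC[k+1]≡[n+1]C[k+1] b j)

𝟙 : ∀ {p} {P : Set p} → Dec P → ℕ
𝟙 (yes _) = 1
𝟙 (no _)  = 0

𝟙-yes : ∀ {p} {P : Set p} (P? : Dec P) → P → 𝟙 P? ≡ 1
𝟙-yes (yes _) _ = refl
𝟙-yes (no ¬p) p = ⊥-elim (¬p p)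

𝟙-no : ∀ {p} {P : Set p} (P? : Dec P) → ¬ P → 𝟙 P? ≡ 0
𝟙-no (yes p) ¬p = ⊥-elim (¬p p)
𝟙-no (no _)  _  = refl

𝟙-⇔ : ∀ {p q} {P : Set p} {Q : Set q} (P? : Dec P) (Q? : Dec Q) →
  (P → Q) → (Q → P) → 𝟙 P? ≡ 𝟙 Q?
𝟙-⇔ (yes _) (yes _) _ _ = refl
𝟙-⇔ (yes p) (no ¬q) f _ = ⊥-elim (¬q (f p))
𝟙-⇔ (no ¬p) (yes q) _ g = ⊥-elim (¬p (g q))
𝟙-⇔ (no _)  (no _)  _ _ = refl

𝟙-× : ∀ {p q} {P : Set p} {Q : Set q} (P? : Dec P) (Q? : Dec Q) →
  𝟙 (P? ×-dec Q?) ≡ 𝟙 P? * 𝟙 Q?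
𝟙-× (yes _) (yes _) = refl
𝟙-× (yes _) (no _)  = refl
𝟙-× (no _)  (yes _) = refl
𝟙-× (no _)  (no _)  = refl

length-filter : ∀ {a p} {A : Set a} {P : A → Set p} (P? : ∀ x → Dec (P x)) xs →
  length (filter P? xs) ≡ ∑ xs (𝟙 ∘ P?)
length-filter P? []       = refl
length-filter P? (x ∷ xs) with P? x
... | yes _ = cong suc (length-filter P? xs)
... | no _  = length-filter P? xs

∑<-truncate : ∀ n b h → b ≤ n → ∑< n (λ i → 𝟙 (i <? b) * h i) ≡ ∑< b h
∑<-truncate n b h b≤n with m≤n⇒m<n∨m≡n b≤n
... | inj₂ refl = ∑<-cong n (λ i i<n → trans (cong (_* h i) (𝟙-yes (i <? n) i<n)) (+-identityʳ (h i)))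
∑<-truncate (suc n) b h _ | inj₁ (s≤s b≤n)
  rewrite ∑<-truncate n b h b≤n | 𝟙-no (n <? b) (≤⇒≯ b≤n) = +-identityʳ _

∑<-exactly-one : ∀ {p} {P : ℕ → Set p} M (P? : ∀ j → Dec (P j)) j₀ → j₀ < M → P j₀ →
  (∀ j j' → j < j' → j' < M → P j → P j' → ⊥) → ∑< M (𝟙 ∘ P?) ≡ 1
∑<-exactly-one (suc M) P? j₀ (s≤s j₀≤M) pj₀ unique with m≤n⇒m<n∨m≡n j₀≤M
... | inj₂ refl
  rewrite ∑<-zero M (𝟙 ∘ P?) (λ j j<M → 𝟙-no (P? j) (λ pj → unique j j₀ j<M ≤-refl pj pj₀))
        | 𝟙-yes (P? j₀) pj₀ = refl
... | inj₁ j₀<M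
  rewrite ∑<-exactly-one M P? j₀ j₀<M pj₀ (λ j j' j<j' j'<M → unique j j' j<j' (m<n⇒m<1+n j'<M))
        | 𝟙-no (P? M) (λ pM → unique j₀ M j₀<M ≤-refl pj₀ pM) = refl

∑-allWords-suc : ∀ k j (f : Word k (suc j) → ℕ) →
  ∑ (allWords k (suc j)) f ≡ ∑ (allFin k) (λ a → ∑ (allWords k j) (λ v → f (a ∷ v)))
∑-allWords-suc k j f =
  trans (∑-concatMap _ (allFin k) f) (∑-cong (allFin k) (λ a → ∑-map (a ∷_) (allWords k j) f))

∑-allWords-++ : ∀ k m j (f : Word k (m + j) → ℕ) →
  ∑ (allWords k (m + j)) f ≡ ∑ (allWords k m) (λ u → ∑ (allWords k j) (λ v → f (u ++ᵥ v)))
∑-allWords-++ k zero    j f = sym (+-identityʳ _)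
∑-allWords-++ k (suc m) j f = begin
  ∑ (allWords k (suc m + j)) f
    ≡⟨ ∑-allWords-suc k (m + j) f ⟩
  ∑ (allFin k) (λ a → ∑ (allWords k (m + j)) (f ∘ (a ∷_)))
    ≡⟨ ∑-cong (allFin k) (λ a → ∑-allWords-++ k m j (f ∘ (a ∷_))) ⟩
  ∑ (allFin k) (λ a → ∑ (allWords k m) (λ u → ∑ (allWords k j) (λ v → f (a ∷ (u ++ᵥ v)))))
    ≡⟨ sym (∑-allWords-suc k m _) ⟩
  ∑ (allWords k (suc m)) (λ u → ∑ (allWords k j) (λ v → f (u ++ᵥ v))) ∎
  where open ≡-Reasoning

DecreasingBelow : ∀ {k j} → ℕ → Word k j → Set
DecreasingBelow b []      = ⊤
DecreasingBelow b (x ∷ v) = toℕ x < b × DecreasingBelow (toℕ x) v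

decreasingBelow? : ∀ {k j} b (v : Word k j) → Dec (DecreasingBelow b v)
decreasingBelow? b []      = yes tt
decreasingBelow? b (x ∷ v) = (toℕ x <? b) ×-dec decreasingBelow? (toℕ x) v

-- choosing the first letter i < b leaves C(i,j) choices for the rest, and
-- Σ_{i<b} C(i,j) = C(b,j+1); in particular there are C(k,j) of length j
count-decreasing : ∀ k j b → b ≤ k → ∑ (allWords k j) (𝟙 ∘ decreasingBelow? b) ≡ b C j
count-decreasing k zero    b _   = refl
count-decreasing k (suc j) b b≤k = begin
  ∑ (allWords k (suc j)) (𝟙 ∘ decreasingBelow? b)
    ≡⟨ ∑-allWords-suc k j _ ⟩
  ∑ (allFin k) (λ a → ∑ (allWords k j) (λ v → 𝟙 ((toℕ a <? b) ×-dec decreasingBelow? (toℕ a) v)))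
    ≡⟨ ∑-cong (allFin k) (λ a → ∑-cong (allWords k j) (λ v → 𝟙-× (toℕ a <? b) (decreasingBelow? (toℕ a) v))) ⟩
  ∑ (allFin k) (λ a → ∑ (allWords k j) (λ v → 𝟙 (toℕ a <? b) * 𝟙 (decreasingBelow? (toℕ a) v)))
    ≡⟨ ∑-cong (allFin k) (λ a → ∑-*ˡ (allWords k j) (𝟙 (toℕ a <? b)) _) ⟩
  ∑ (allFin k) (λ a → 𝟙 (toℕ a <? b) * ∑ (allWords k j) (𝟙 ∘ decreasingBelow? (toℕ a)))
    ≡⟨ ∑-tabulate k (λ a → a) _ (λ i → 𝟙 (i <? b) * (i C j))
         (λ a → cong (𝟙 (toℕ a <? b) *_) (count-decreasing k j (toℕ a) (<⇒≤ (toℕ<n a)))) ⟩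
  ∑< k (λ i → 𝟙 (i <? b) * (i C j))
    ≡⟨ ∑<-truncate k b _ b≤k ⟩
  ∑< b (λ i → i C j)
    ≡⟨ hockey-stick b j ⟩
  b C suc j ∎
  where open ≡-Reasoning

AdjacentDecreasing : ∀ {k j} → Word k j → Set
AdjacentDecreasing {k} {j} v =
  ∀ (r r' : Fin j) → toℕ r' ≡ suc (toℕ r) → toℕ (lookup v r') < toℕ (lookup v r)

decreasingBelow-bound : ∀ {k j} b (v : Word k j) → DecreasingBelow b v → ∀ r → toℕ (lookup v r) < b
decreasingBelow-bound b (x ∷ v) (x<b , _)    fz     = x<b
decreasingBelow-bound b (x ∷ v) (x<b , decr) (fs r) = <-trans (decreasingBelow-bound (toℕ x) v decr r) x<b

decreasingBelow⇒adjacent : ∀ {k j} b (v : Word k j) → DecreasingBelow b v → AdjacentDecreasing v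
decreasingBelow⇒adjacent b (x ∷ v) (_ , decr) fz     (fs r') _ = decreasingBelow-bound (toℕ x) v decr r'
decreasingBelow⇒adjacent b (x ∷ v) (_ , decr) (fs r) (fs r') e =
  decreasingBelow⇒adjacent (toℕ x) v decr r r' (suc-injective e)

adjacent-tail : ∀ {k j} x (v : Word k j) → AdjacentDecreasing (x ∷ v) → AdjacentDecreasing v
adjacent-tail x v adj r r' e = adj (fs r) (fs r') (cong suc e)

adjacent-head : ∀ {k j} x (v : Word k j) → AdjacentDecreasing (x ∷ v) → ∀ r → toℕ (lookup v r) < toℕ x
adjacent-head x (y ∷ v) adj fz     = adj fz (fs fz) refl
adjacent-head x (y ∷ v) adj (fs r) =
  <-trans (adjacent-head y v (adjacent-tail x (y ∷ v) adj) r) (adj fz (fs fz) refl)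

adjacent⇒decreasingBelow : ∀ {k j} b (v : Word k j) →
  (∀ r → toℕ (lookup v r) < b) → AdjacentDecreasing v → DecreasingBelow b v
adjacent⇒decreasingBelow b []      bound adj = tt
adjacent⇒decreasingBelow b (x ∷ v) bound adj =
  bound fz , adjacent⇒decreasingBelow (toℕ x) v (adjacent-head x v adj) (adjacent-tail x v adj)

Descending : ∀ {k n} → Word k n → Set
Descending {k} {n} w = ∀ (i p p' : Fin n) → toℕ i < toℕ p → toℕ p' ≡ suc (toℕ p) →
  lookup w i ≡ lookup w p → toℕ (lookup w p') < toℕ (lookup w p)

avoiding⇒descending : ∀ {k n} (w : Word k n) → ¬ Contains1-11 w → ¬ Contains1-12 w → Descending w
avoiding⇒descending w no11 no12 i p p' i<p p'≡p+1 eq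
  with <-cmp (toℕ (lookup w p')) (toℕ (lookup w p))
... | tri< smaller _ _ = smaller
... | tri≈ _ same _    = ⊥-elim (no11 (i , p , p' , i<p , p'≡p+1 , eq , sym (toℕ-injective same)))
... | tri> _ _ larger  = ⊥-elim (no12 (i , p , p' , i<p , p'≡p+1 , eq , larger))

descending⇒¬1-11 : ∀ {k n} (w : Word k n) → Descending w → ¬ Contains1-11 w
descending⇒¬1-11 w desc (i , p , p' , i<p , p'≡p+1 , eq , eq') =
  <-irrefl (cong toℕ (sym eq')) (desc i p p' i<p p'≡p+1 eq)

descending⇒¬1-12 : ∀ {k n} (w : Word k n) → Descending w → ¬ Contains1-12 w
descending⇒¬1-12 w desc (i , p , p' , i<p , p'≡p+1 , eq , larger) =
  <-asym larger (desc i p p' i<p p'≡p+1 eq)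

IsRepeat : ∀ {k n} → Word k n → Fin n → Set
IsRepeat {k} {n} w p = ∃ λ (i : Fin n) → toℕ i < toℕ p × lookup w i ≡ lookup w p

isRepeat? : ∀ {k n} (w : Word k n) p → Dec (IsRepeat w p)
isRepeat? w p = any? λ i → (toℕ i <? toℕ p) ×-dec (lookup w i ≟ᶠ lookup w p)

firstOccurrence : ∀ {k n} (w : Word k n) (p : Fin n) →
  ∃ λ p₀ → lookup w p₀ ≡ lookup w p × ¬ IsRepeat w p₀
firstOccurrence {n = n} w p = go n p (toℕ<n p)
  where
  go : ∀ bound (p : Fin n) → toℕ p < bound → ∃ λ p₀ → lookup w p₀ ≡ lookup w p × ¬ IsRepeat w p₀
  go (suc bound) p (s≤s p≤bound) with isRepeat? w p
  ... | no notRepeat = p , refl , notRepeat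
  ... | yes (i , i<p , same) with go bound i (<-≤-trans i<p p≤bound)
  ...   | p₀ , same₀ , first = p₀ , trans same₀ same , first

RepeatedTail : ∀ {k n} → ℕ → Word k n → Set
RepeatedTail {k} {n} j w =
  (∀ p → n ≤ toℕ p + j → IsRepeat w p) × (∀ p → suc (toℕ p + j) ≡ n → ¬ IsRepeat w p)

repeatedTail? : ∀ {k n} j (w : Word k n) → Dec (RepeatedTail j w)
repeatedTail? {n = n} j w =
  all? (λ p → (n ≤? toℕ p + j) →-dec isRepeat? w p) ×-dec
  all? (λ p → (suc (toℕ p + j) ≟ n) →-dec ¬? (isRepeat? w p))

positionBefore : ∀ {N} j → j < N → ∃ λ (p : Fin N) → suc (toℕ p + j) ≡ N
positionBefore {N} j j<N = fromℕ< d<N , (begin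
  suc (toℕ (fromℕ< d<N) + j) ≡⟨ cong (λ d → suc (d + j)) (toℕ-fromℕ< d<N) ⟩
  suc (N ∸ suc j + j)        ≡⟨ sym (+-suc (N ∸ suc j) j) ⟩
  N ∸ suc j + suc j          ≡⟨ m∸n+n≡m j<N ⟩
  N                          ∎)
  where
  open ≡-Reasoning
  d<N : N ∸ suc j < N
  d<N = ∸-monoʳ-< {o = 0} z<s j<N

positionBefore-unique : ∀ {N} j (p q : Fin N) → suc (toℕ p + j) ≡ N → suc (toℕ q + j) ≡ N → p ≡ q
positionBefore-unique j p q ep eq = toℕ-injective (+-cancelʳ-≡ j _ _ (suc-injective (trans ep (sym eq))))

-- two different tail lengths j < j' ≤ N would disagree on the position
-- just before the shorter tail
repeatedTail-unique : ∀ {k N} (w : Word k N) j j' → j < j' → j' ≤ N →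
  RepeatedTail j w → RepeatedTail j' w → ⊥
repeatedTail-unique {N = N} w j j' j<j' j'≤N (_ , beforeTail) (inTail' , _)
  with positionBefore j (<-≤-trans j<j' j'≤N)
... | p , e = beforeTail p e (inTail' p (subst (_≤ toℕ p + j') (trans (+-suc (toℕ p) j) e) (+-monoʳ-≤ (toℕ p) j<j')))

-- scanning w from the right, the tail grows while positions are repeats
repeatedTail-exists : ∀ {k N} (w : Word k N) → ∃ λ j → j ≤ N × RepeatedTail j w
repeatedTail-exists {N = N} w = scan N 0 (+-identityʳ N) emptyTail
  where
  emptyTail : ∀ p → N ≤ toℕ p + 0 → IsRepeat w p
  emptyTail p N≤p = ⊥-elim (<⇒≱ (toℕ<n p) (subst (N ≤_) (+-identityʳ (toℕ p)) N≤p))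

  -- invariant: d + j = N and the last j positions are repeats
  scan : ∀ d j → d + j ≡ N → (∀ p → N ≤ toℕ p + j → IsRepeat w p) → ∃ λ j → j ≤ N × RepeatedTail j w
  scan zero    j refl inTail =
    j , ≤-refl , inTail , λ p e _ → <-irrefl (sym e) (s≤s (m≤n+m j (toℕ p)))
  scan (suc d) j d+j≡N inTail with positionBefore j (subst (j <_) d+j≡N (s≤s (m≤n+m j d)))
  ... | p , before with isRepeat? w p
  ...   | no notRepeat =
    j , subst (j ≤_) d+j≡N (m≤n+m j (suc d)) , inTail ,
    λ p' before' → subst (λ q → ¬ IsRepeat w q) (positionBefore-unique j p p' before before') notRepeat
  ...   | yes repeat = scan d (suc j) (trans (+-suc d j) d+j≡N) inTail'
    where
    inTail' : ∀ p' → N ≤ toℕ p' + suc j → IsRepeat w p'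
    inTail' p' le with m≤n⇒m<n∨m≡n (subst (N ≤_) (+-suc (toℕ p') j) le)
    ... | inj₁ N<p'+j+1 = inTail p' (≤-pred N<p'+j+1)
    ... | inj₂ N≡p'+j+1 = subst (IsRepeat w) (positionBefore-unique j p p' before (sym N≡p'+j+1)) repeat

repeatedTail-partition : ∀ {k N} (w : Word k N) → ∑< (suc N) (λ j → 𝟙 (repeatedTail? j w)) ≡ 1
repeatedTail-partition {N = N} w with repeatedTail-exists w
... | j₀ , j₀≤N , tail =
  ∑<-exactly-one (suc N) (λ j → repeatedTail? j w) j₀ (s≤s j₀≤N) tail
    (λ j j' j<j' j'<N+1 → repeatedTail-unique w j j' j<j' (≤-pred j'<N+1))

lastLetterUnique⇒lastNew : ∀ {k m} (u : Word k m) → LastLetterUnique u →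
  ∀ q → suc (toℕ q) ≡ m → ¬ IsRepeat u q
lastLetterUnique⇒lastNew {m = suc m'} u unique q last (i , i<q , same) =
  unique i (λ i≡last → <-irrefl (cong toℕ (trans i≡last (sym q≡last))) i<q) (trans same (cong (lookup u) q≡last))
  where
  q≡last : q ≡ fromℕ m'
  q≡last = toℕ-injective (trans (suc-injective last) (sym (toℕ-fromℕ m')))

lastNew⇒lastLetterUnique : ∀ {k m} (u : Word k m) →
  (∀ q → suc (toℕ q) ≡ m → ¬ IsRepeat u q) → LastLetterUnique u
lastNew⇒lastLetterUnique {m = zero}   u new = tt
lastNew⇒lastLetterUnique {m = suc m'} u new p p≢last same =
  new (fromℕ m') (cong suc (toℕ-fromℕ m')) (p , p<last , same)
  where
  p<last : toℕ p < toℕ (fromℕ m')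
  p<last = subst (toℕ p <_) (sym (toℕ-fromℕ m'))
    (≤∧≢⇒< (toℕ≤pred[n] p) (λ e → p≢last (toℕ-injective (trans e (sym (toℕ-fromℕ m'))))))

module Split {k m j : ℕ} (u : Word k m) (v : Word k j) where

  W : Word k (m + j)
  W = u ++ᵥ v

  L : Fin m → Fin (m + j)
  L q = q ↑ˡ j

  R : Fin j → Fin (m + j)
  R r = m ↑ʳ r

  lookup-L : ∀ q → lookup W (L q) ≡ lookup u q
  lookup-L q = lookup-++ˡ u v q

  lookup-R : ∀ r → lookup W (R r) ≡ lookup v r
  lookup-R r = lookup-++ʳ u v r

  toℕ-L : ∀ q → toℕ (L q) ≡ toℕ q
  toℕ-L q = toℕ-↑ˡ q j

  toℕ-R : ∀ r → toℕ (R r) ≡ m + toℕ r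
  toℕ-R r = toℕ-↑ʳ m r

  L<m : ∀ q → toℕ (L q) < m
  L<m q = subst (_< m) (sym (toℕ-L q)) (toℕ<n q)

  m≤R : ∀ r → m ≤ toℕ (R r)
  m≤R r = subst (m ≤_) (sym (toℕ-R r)) (m≤m+n m (toℕ r))

  view : ∀ p → (∃ λ q → L q ≡ p) ⊎ (∃ λ r → R r ≡ p)
  view p with splitAt m p in eq
  ... | inj₁ q = inj₁ (q , splitAt⁻¹-↑ˡ eq)
  ... | inj₂ r = inj₂ (r , splitAt⁻¹-↑ʳ eq)

  left : ∀ p → toℕ p < m → ∃ λ q → L q ≡ p
  left p p<m with view p
  ... | inj₁ isLeft = isLeft
  ... | inj₂ (r , refl) = ⊥-elim (<⇒≱ p<m (m≤R r))

  right : ∀ p → m ≤ toℕ p → ∃ λ r → R r ≡ p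
  right p m≤p with view p
  ... | inj₂ isRight = isRight
  ... | inj₁ (q , refl) = ⊥-elim (<⇒≱ (L<m q) m≤p)

  repeat-L : ∀ q → IsRepeat u q → IsRepeat W (L q)
  repeat-L q (i , i<q , same) =
    L i , subst₂ _<_ (sym (toℕ-L i)) (sym (toℕ-L q)) i<q , trans (lookup-L i) (trans same (sym (lookup-L q)))

  repeat-L⁻ : ∀ q → IsRepeat W (L q) → IsRepeat u q
  repeat-L⁻ q (i , i<q , same) with left i (<-trans i<q (L<m q))
  ... | qi , refl =
    qi , subst₂ _<_ (toℕ-L qi) (toℕ-L q) i<q , trans (sym (lookup-L qi)) (trans same (lookup-L q))

  next-R : ∀ r p' → toℕ p' ≡ suc (toℕ (R r)) → ∃ λ r' → R r' ≡ p' × toℕ r' ≡ suc (toℕ r)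
  next-R r p' p'≡p+1 with right p' (subst (m ≤_) (sym p'≡p+1) (m≤n⇒m≤1+n (m≤R r)))
  ... | r' , refl = r' , refl , +-cancelˡ-≡ m _ _ (begin
    m + toℕ r'       ≡⟨ sym (toℕ-R r') ⟩
    toℕ (R r')       ≡⟨ p'≡p+1 ⟩
    suc (toℕ (R r))  ≡⟨ cong suc (toℕ-R r) ⟩
    suc (m + toℕ r)  ≡⟨ sym (+-suc m (toℕ r)) ⟩
    m + suc (toℕ r)  ∎)
    where open ≡-Reasoning

  -- the right part is a repeated tail, so descent inside it is adjacent decrease
  descending⇒adjacent : Descending W → (∀ r → IsRepeat W (R r)) → AdjacentDecreasing v
  descending⇒adjacent descW repeats r r' r'≡r+1 with repeats r
  ... | i , i<p , same = subst₂ (λ a b → toℕ a < toℕ b) (lookup-R r') (lookup-R r)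
    (descW i (R r) (R r') i<p (trans (toℕ-R r') (trans (cong (m +_) r'≡r+1) (trans (+-suc m _) (cong suc (sym (toℕ-R r)))))) same)

  module FromWord (allW : AllLettersOccur W) (descW : Descending W) (tail : RepeatedTail j W) where

    descU : Descending u
    descU i p p' i<p p'≡p+1 same = subst₂ (λ a b → toℕ a < toℕ b) (lookup-L p') (lookup-L p)
      (descW (L i) (L p) (L p') (subst₂ _<_ (sym (toℕ-L i)) (sym (toℕ-L p)) i<p)
        (trans (toℕ-L p') (trans p'≡p+1 (cong suc (sym (toℕ-L p)))))
        (trans (lookup-L i) (trans same (sym (lookup-L p)))))

    -- the first occurrence of a letter is not a repeat, so it lies in u
    allU : AllLettersOccur u
    allU a with allW a
    ... | p , at-p with firstOccurrence W p
    ...   | p₀ , same , first with m ≤? toℕ p₀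
    ...     | yes m≤p₀ = ⊥-elim (first (proj₁ tail p₀ (+-monoˡ-≤ j m≤p₀)))
    ...     | no  m≰p₀ with left p₀ (≰⇒> m≰p₀)
    ...       | q , refl = q , trans (sym (lookup-L q)) (trans same at-p)

    lastNew : ∀ q → suc (toℕ q) ≡ m → ¬ IsRepeat u q
    lastNew q last rep =
      proj₂ tail (L q) (trans (cong (λ x → suc (x + j)) (toℕ-L q)) (cong (_+ j) last)) (repeat-L q rep)

    adjV : AdjacentDecreasing v
    adjV = descending⇒adjacent descW (λ r → proj₁ tail (R r) (+-monoˡ-≤ j (m≤R r)))

  module ToWord (allU : AllLettersOccur u) (descU : Descending u)
                (lastNew : ∀ q → suc (toℕ q) ≡ m → ¬ IsRepeat u q) (adjV : AdjacentDecreasing v) where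

    allW : AllLettersOccur W
    allW a with allU a
    ... | q , at-q = L q , trans (lookup-L q) at-q

    -- the letter after a repeat at L q lies in u (by descU), or q is last
    -- in u, which is impossible since the last letter of u is new
    descW : Descending W
    descW i p p' i<p p'≡p+1 same with view p
    descW i p p' i<p p'≡p+1 same | inj₂ (r , refl) with next-R r p' p'≡p+1
    ... | r' , refl , r'≡r+1 =
      subst₂ (λ a b → toℕ a < toℕ b) (sym (lookup-R r')) (sym (lookup-R r)) (adjV r r' r'≡r+1)
    descW i p p' i<p p'≡p+1 same | inj₁ (q , refl) with repeat-L⁻ q (i , i<p , same) | view p'
    ... | qi , qi<q , sameU | inj₁ (q' , refl) =
      subst₂ (λ a b → toℕ a < toℕ b) (sym (lookup-L q')) (sym (lookup-L q))
        (descU qi q q' qi<q (trans (sym (toℕ-L q')) (trans p'≡p+1 (cong suc (toℕ-L q)))) sameU)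
    ... | rep | inj₂ (r' , refl) = ⊥-elim (lastNew q last rep)
      where
      last : suc (toℕ q) ≡ m
      last = ≤-antisym (subst (_< m) (toℕ-L q) (L<m q))
                       (subst (m ≤_) (trans p'≡p+1 (cong suc (toℕ-L q))) (m≤R r'))

    -- each letter of v occurs in u, i.e. earlier in W
    inTail : ∀ p → m + j ≤ toℕ p + j → IsRepeat W p
    inTail p m+j≤p+j with right p (+-cancelʳ-≤ j m (toℕ p) m+j≤p+j)
    ... | r , refl with allU (lookup v r)
    ...   | q , at-q = L q , <-≤-trans (L<m q) (m≤R r) , trans (lookup-L q) (trans at-q (sym (lookup-R r)))

    beforeTail : ∀ p → suc (toℕ p + j) ≡ m + j → ¬ IsRepeat W p
    beforeTail p before = lastPosition (left p (subst (toℕ p <_) last (n<1+n (toℕ p))))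
      where
      last : suc (toℕ p) ≡ m
      last = +-cancelʳ-≡ j _ _ before

      lastPosition : (∃ λ q → L q ≡ p) → ¬ IsRepeat W p
      lastPosition (q , Lq≡p) rep =
        lastNew q (trans (cong suc (trans (sym (toℕ-L q)) (cong toℕ Lq≡p))) last)
                  (repeat-L⁻ q (subst (IsRepeat W) (sym Lq≡p) rep))

  split⇒ : Counted W × RepeatedTail j W → (Counted u × LastLetterUnique u) × DecreasingBelow k v
  split⇒ ((allW , no11 , no12) , tail) =
    ((allU , descending⇒¬1-11 u descU , descending⇒¬1-12 u descU) , lastNew⇒lastLetterUnique u lastNew) ,
    adjacent⇒decreasingBelow k v (λ r → toℕ<n (lookup v r)) adjV
    where open FromWord allW (avoiding⇒descending W no11 no12) tail

  split⇐ : (Counted u × LastLetterUnique u) × DecreasingBelow k v → Counted W × RepeatedTail j W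
  split⇐ (((allU , no11 , no12) , unique) , decr) =
    (allW , descending⇒¬1-11 W descW , descending⇒¬1-12 W descW) , inTail , beforeTail
    where open ToWord allU (avoiding⇒descending u no11 no12) (lastLetterUnique⇒lastNew u unique)
                      (decreasingBelow⇒adjacent k v decr)

countedWithTail? : ∀ {k n} j (w : Word k n) → Dec (Counted w × RepeatedTail j w)
countedWithTail? j w = counted? w ×-dec repeatedTail? j w

-- by fact 3 the words of length m + j counted with tail length j are the
-- products u ++ v of a word counted by c_{m,k} and one of C(k,j) decreasing words
count-with-tail : ∀ k m j → ∑ (allWords k (m + j)) (𝟙 ∘ countedWithTail? j) ≡ (k C j) * c m k
count-with-tail k m j = begin
  ∑ (allWords k (m + j)) (𝟙 ∘ countedWithTail? j)
    ≡⟨ ∑-allWords-++ k m j _ ⟩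
  ∑ (allWords k m) (λ u → ∑ (allWords k j) (λ v → 𝟙 (countedWithTail? j (u ++ᵥ v))))
    ≡⟨ ∑-cong (allWords k m) (λ u → ∑-cong (allWords k j) (λ v →
         trans (𝟙-⇔ (countedWithTail? j (u ++ᵥ v)) (countedLast? u ×-dec decreasingBelow? k v)
                    (Split.split⇒ u v) (Split.split⇐ u v))
               (𝟙-× (countedLast? u) (decreasingBelow? k v)))) ⟩
  ∑ (allWords k m) (λ u → ∑ (allWords k j) (λ v → 𝟙 (countedLast? u) * 𝟙 (decreasingBelow? k v)))
    ≡⟨ ∑-cong (allWords k m) (λ u → ∑-*ˡ (allWords k j) (𝟙 (countedLast? u)) _) ⟩
  ∑ (allWords k m) (λ u → 𝟙 (countedLast? u) * ∑ (allWords k j) (𝟙 ∘ decreasingBelow? k))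
    ≡⟨ ∑-cong (allWords k m) (λ u → cong (𝟙 (countedLast? u) *_) (count-decreasing k j k ≤-refl)) ⟩
  ∑ (allWords k m) (λ u → 𝟙 (countedLast? u) * (k C j))
    ≡⟨ ∑-*ʳ (allWords k m) (k C j) (𝟙 ∘ countedLast?) ⟩
  ∑ (allWords k m) (𝟙 ∘ countedLast?) * (k C j)
    ≡⟨ cong (_* (k C j)) (sym (length-filter countedLast? (allWords k m))) ⟩
  c m k * (k C j)
    ≡⟨ *-comm (c m k) (k C j) ⟩
  (k C j) * c m k ∎
  where open ≡-Reasoning

count-with-tail-≤ : ∀ k n j → j ≤ n → ∑ (allWords k n) (𝟙 ∘ countedWithTail? j) ≡ (k C j) * c (n ∸ j) k
count-with-tail-≤ k n j j≤n =
  subst (λ N → ∑ (allWords k N) (𝟙 ∘ countedWithTail? j) ≡ (k C j) * c (n ∸ j) k)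
        (m∸n+n≡m j≤n) (count-with-tail k (n ∸ j) j)

-- by fact 2 each counted word has exactly one tail length j ≤ n
counted-by-tail : ∀ {k n} (w : Word k n) → 𝟙 (counted? w) ≡ ∑< (suc n) (λ j → 𝟙 (countedWithTail? j w))
counted-by-tail {n = n} w = sym (begin
  ∑< (suc n) (λ j → 𝟙 (countedWithTail? j w))
    ≡⟨ ∑<-cong (suc n) (λ j _ → 𝟙-× (counted? w) (repeatedTail? j w)) ⟩
  ∑< (suc n) (λ j → 𝟙 (counted? w) * 𝟙 (repeatedTail? j w))
    ≡⟨ ∑<-*ˡ (suc n) (𝟙 (counted? w)) _ ⟩
  𝟙 (counted? w) * ∑< (suc n) (λ j → 𝟙 (repeatedTail? j w))
    ≡⟨ cong (𝟙 (counted? w) *_) (repeatedTail-partition w) ⟩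
  𝟙 (counted? w) * 1
    ≡⟨ *-identityʳ _ ⟩
  𝟙 (counted? w) ∎)
  where open ≡-Reasoning

mainTheorem10 : ∀ (k n : ℕ) → α n k ≡ coeffProduct n k
mainTheorem10 k n = begin
  α n k
    ≡⟨ length-filter counted? (allWords k n) ⟩
  ∑ (allWords k n) (𝟙 ∘ counted?)
    ≡⟨ ∑-cong (allWords k n) counted-by-tail ⟩
  ∑ (allWords k n) (λ w → ∑< (suc n) (λ j → 𝟙 (countedWithTail? j w)))
    ≡⟨ ∑-∑< (allWords k n) (suc n) (λ w j → 𝟙 (countedWithTail? j w)) ⟩
  ∑< (suc n) (λ j → ∑ (allWords k n) (𝟙 ∘ countedWithTail? j))
    ≡⟨ ∑<-cong (suc n) (λ j j<1+n → count-with-tail-≤ k n j (≤-pred j<1+n)) ⟩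
  ∑< (suc n) (λ j → (k C j) * c (n ∸ j) k)
    ≡⟨ sym (∑-upTo (suc n) _) ⟩
  coeffProduct n k ∎
  where open ≡-Reasoning
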